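{- Let $G=(V,E)$ be a graph with neither isolated vertices nor isolated edges, whose vertices fail randomly and independently, vertex $v$ with probability $q_v=1-p_v$, $\mathbf{p}=(p_v)_{v\in V}\in[0,1]^V$. Let $A\subseteq V$ be any set of vertices each of which is adjacent to a vertex of degree $1$. Then \[\operatorname{DRel}(G,\mathbf{p})=\sum_{J\subseteq V\setminus A}(-1)^{|J|}\prod_{v\in N_G[J]}q_v.\]
   Context: All graphs are finite, undirected and simple; edges never fail. An isolated edge is an edge both of whose endpoints have degree 1. $\operatorname{DRel}(G,\mathbf{p})$ is the probability that the set of operating vertices is a dominating set (every vertex not in it is adjacent to a vertex in it). $N_G[J]$ is the closed neighbourhood of $J$ (vertices in $J$ or adjacent to a vertex of $J$). -}

module Defs where

open import Level using (Level)
open import Algebra.Bundles using (CommutativeRing)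
open import Data.Bool using (Bool; true; false; _∧_; _∨_; not; if_then_else_)
open import Data.Nat using (ℕ; zero; suc)
open import Data.Fin using (Fin; zero; suc)
open import Data.List using (List; []; _∷_; _++_; map; foldr; allFin)
open import Data.Product using (Σ; _×_; _,_)
open import Relation.Binary.PropositionalEquality using (_≡_)
open import Relation.Nullary using (¬_)

record Graph (n : ℕ) : Set where
  field
    adj    : Fin n → Fin n → Bool
    sym    : ∀ u v → adj u v ≡ adj v u
    irrefl : ∀ v → adj v v ≡ false
open Graph public

VSet : ℕ → Set
VSet n = Fin n → Bool

-- Enumeration of all 2^n subsets of Fin n (each exactly once).
cons : ∀ {n} → Bool → VSet n → VSet (suc n)
cons b S zero    = b
cons b S (suc i) = S i

allSubsets : (n : ℕ) → List (VSet n)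
allSubsets zero    = (λ ()) ∷ []
allSubsets (suc n) = map (cons false) (allSubsets n) ++ map (cons true) (allSubsets n)

anyV : ∀ {n} → (Fin n → Bool) → Bool
anyV f = foldr (λ i b → f i ∨ b) false (allFin _)

allV : ∀ {n} → (Fin n → Bool) → Bool
allV f = foldr (λ i b → f i ∧ b) true (allFin _)

countV : ∀ {n} → (Fin n → Bool) → ℕ
countV f = foldr (λ i k → if f i then suc k else k) 0 (allFin _)

deg : ∀ {n} → Graph n → Fin n → ℕ
deg G v = countV (adj G v)

card : ∀ {n} → VSet n → ℕ
card S = countV S

NoIsolatedVertices : ∀ {n} → Graph n → Set
NoIsolatedVertices G = ∀ v → ¬ (deg G v ≡ 0)

NoIsolatedEdges : ∀ {n} → Graph n → Set
NoIsolatedEdges G = ∀ u v → adj G u v ≡ true → ¬ (deg G u ≡ 1 × deg G v ≡ 1)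

AdjToLeaf : ∀ {n} → Graph n → VSet n → Set
AdjToLeaf G A = ∀ v → A v ≡ true → Σ _ λ u → adj G v u ≡ true × deg G u ≡ 1

isDominating : ∀ {n} → Graph n → VSet n → Bool
isDominating G S = allV (λ v → S v ∨ anyV (λ u → S u ∧ adj G u v))

closedNbhd : ∀ {n} → Graph n → VSet n → VSet n
closedNbhd G J v = J v ∨ anyV (λ u → J u ∧ adj G u v)

disjointFrom : ∀ {n} → VSet n → VSet n → Bool
disjointFrom J A = not (anyV (λ v → J v ∧ A v))

module RingDefs {c ℓ : Level} (R : CommutativeRing c ℓ) where
  open CommutativeRing R

  sumL : ∀ {A : Set} → List A → (A → Carrier) → Carrier
  sumL xs f = foldr (λ x acc → f x + acc) 0# xs

  prodV : ∀ {n} → (Fin n → Carrier) → Carrier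
  prodV {n} f = foldr (λ i acc → f i * acc) 1# (allFin n)

  negOnePow : ℕ → Carrier
  negOnePow zero    = 1#
  negOnePow (suc k) = (- 1#) * negOnePow k

  qOf : ∀ {n} → (Fin n → Carrier) → Fin n → Carrier
  qOf p v = 1# - p v

  DRel : ∀ {n} → Graph n → (Fin n → Carrier) → Carrier
  DRel {n} G p = sumL (allSubsets n) λ S →
    if isDominating G S
      then prodV (λ v → if S v then p v else qOf p v)
      else 0#

  rhs : ∀ {n} → Graph n → VSet n → (Fin n → Carrier) → Carrier
  rhs {n} G A p = sumL (allSubsets n) λ J →
    if disjointFrom J A
      then negOnePow (card J) * prodV (λ v → if closedNbhd G J v then qOf p v else 1#)
      else 0#

-- Expand each Π_{v ∈ N[J]} q_v as the probability that the random operating set S avoids N[J], and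
-- exchange the sums over J and S.  Since S avoids N[J] exactly when J avoids N[S], the coefficient
-- of Pr[S] is Σ_{J ⊆ V ∖ (A ∪ N[S])} (-1)^|J|, which is 1 when S dominates V ∖ A and 0 otherwise.
-- Finally, S dominates V ∖ A only if S dominates V: a vertex v ∈ A has a leaf neighbour u; if
-- u ∈ A, then u has a leaf neighbour, which must be v, and uv is an isolated edge; so u ∉ A is
-- dominated, and as v is its only neighbour, u ∈ S or v ∈ S.
module Submission where

open import Defs
open import Level using (Level)
open import Algebra.Bundles using (CommutativeRing; CommutativeMonoid)
open import Data.Bool using (Bool; true; false; _∧_; _∨_; not; if_then_else_)
open import Data.Bool.Properties
  using (∨-commutativeMonoid; ∨-∧-booleanAlgebra; ∧-distribˡ-∨; not-¬)
open import Data.Nat using (ℕ; zero; suc; pred)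
open import Data.Fin using (Fin; zero; suc)
open import Data.List using (List; []; _∷_; _++_; map; foldr; allFin)
open import Data.List.Properties using (foldr-map; map-tabulate)
open import Data.Product using (∃; _×_; _,_)
open import Data.Sum using (_⊎_; inj₁; inj₂)
open import Data.Empty using (⊥-elim)
open import Function using (id; _∘_)
open import Relation.Binary.PropositionalEquality as ≡ using (_≡_; _≢_; refl; cong; cong₂)
import Algebra.Properties.CommutativeSemigroup as CommSemigroupProperties
import Algebra.Lattice.Properties.BooleanAlgebra as BooleanAlgebraProperties
import Algebra.Properties.Group as GroupProperties
import Algebra.Properties.Ring as RingProperties
import Relation.Binary.Reasoning.Setoid as SetoidReasoning

open BooleanAlgebraProperties ∨-∧-booleanAlgebra using (deMorgan₂)

foldr-allFin-suc : ∀ {b} {B : Set b} n (g : Fin (suc n) → B → B) e →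
  foldr g e (allFin (suc n)) ≡ g zero (foldr (g ∘ suc) e (allFin n))
foldr-allFin-suc n g e = cong (g zero) (≡.trans
  (cong (foldr g e) (≡.sym (map-tabulate id suc))) (foldr-map g suc e (allFin n)))

allV-suc : ∀ n (f : Fin (suc n) → Bool) → allV f ≡ f zero ∧ allV (f ∘ suc)
allV-suc n f = foldr-allFin-suc n (λ i b → f i ∧ b) true

anyV-suc : ∀ n (f : Fin (suc n) → Bool) → anyV f ≡ f zero ∨ anyV (f ∘ suc)
anyV-suc n f = foldr-allFin-suc n (λ i b → f i ∨ b) false

countV-suc : ∀ n (f : Fin (suc n) → Bool) →
  countV f ≡ (if f zero then suc (countV (f ∘ suc)) else countV (f ∘ suc))
countV-suc n f = foldr-allFin-suc n (λ i k → if f i then suc k else k) 0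

∧-true⁻ : ∀ {a b} → a ∧ b ≡ true → a ≡ true × b ≡ true
∧-true⁻ {true} b≡true = refl , b≡true

∧-true⁺ : ∀ {a b} → a ≡ true → b ≡ true → a ∧ b ≡ true
∧-true⁺ refl b≡true = b≡true

∨-true⁻ : ∀ {a b} → a ∨ b ≡ true → a ≡ true ⊎ b ≡ true
∨-true⁻ {true}  _      = inj₁ refl
∨-true⁻ {false} b≡true = inj₂ b≡true

∨-trueˡ : ∀ {a b} → a ≡ true → a ∨ b ≡ true
∨-trueˡ refl = refl

∨-trueʳ : ∀ {a b} → b ≡ true → a ∨ b ≡ true
∨-trueʳ {true}  _      = refl
∨-trueʳ {false} b≡true = b≡true

true-ext : ∀ {a b} → (a ≡ true → b ≡ true) → (b ≡ true → a ≡ true) → a ≡ b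
true-ext {true}  {true}  _ _ = refl
true-ext {true}  {false} a⇒b _ = ≡.sym (a⇒b refl)
true-ext {false} {true}  _ b⇒a = b⇒a refl
true-ext {false} {false} _ _ = refl

allV⁻ : ∀ {n} {f : Fin n → Bool} → allV f ≡ true → ∀ v → f v ≡ true
allV⁻ {suc n} {f} all v with ∧-true⁻ {f zero} (≡.trans (≡.sym (allV-suc n f)) all)
allV⁻ _ zero    | f0 , _    = f0
allV⁻ _ (suc v) | _  , rest = allV⁻ rest v

allV⁺ : ∀ {n} {f : Fin n → Bool} → (∀ v → f v ≡ true) → allV f ≡ true
allV⁺ {zero}      _   = refl
allV⁺ {suc n} {f} all = ≡.trans (allV-suc n f) (∧-true⁺ (all zero) (allV⁺ (all ∘ suc)))

anyV⁻ : ∀ {n} {f : Fin n → Bool} → anyV f ≡ true → ∃ λ v → f v ≡ true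
anyV⁻ {suc n} {f} any with ∨-true⁻ {f zero} (≡.trans (≡.sym (anyV-suc n f)) any)
... | inj₁ f0   = zero , f0
... | inj₂ rest with anyV⁻ rest
...   | v , fv = suc v , fv

anyV⁺ : ∀ {n} {f : Fin n → Bool} v → f v ≡ true → anyV f ≡ true
anyV⁺ {suc n} {f} zero    fv = ≡.trans (anyV-suc n f) (∨-trueˡ fv)
anyV⁺ {suc n} {f} (suc v) fv = ≡.trans (anyV-suc n f) (∨-trueʳ {f zero} (anyV⁺ v fv))

countV≡0⇒≢true : ∀ {n} {f : Fin n → Bool} → countV f ≡ 0 → ∀ v → f v ≢ true
countV≡0⇒≢true {suc n} {f} count v with f zero in f0 | ≡.trans (≡.sym (countV-suc n f)) count | v
... | false | _    | zero  = λ fv → not-¬ fv f0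
... | false | rest | suc v = countV≡0⇒≢true rest v

countV≡1⇒unique : ∀ {n} {f : Fin n → Bool} → countV f ≡ 1 →
  ∀ {v w} → f v ≡ true → f w ≡ true → v ≡ w
countV≡1⇒unique {suc n} {f} count {v} {w} fv fw
  with f zero in f0 | ≡.trans (≡.sym (countV-suc n f)) count | v | w
... | true  | _    | zero  | zero  = refl
... | true  | rest | zero  | suc w = ⊥-elim (countV≡0⇒≢true (cong pred rest) w fw)
... | true  | rest | suc v | _     = ⊥-elim (countV≡0⇒≢true (cong pred rest) v fv)
... | false | _    | zero  | _     = ⊥-elim (not-¬ fv f0)
... | false | _    | suc _ | zero  = ⊥-elim (not-¬ fw f0)
... | false | rest | suc v | suc w = cong suc (countV≡1⇒unique rest fv fw)

anyV-∨ : ∀ {n} {f g h : Fin n → Bool} → (∀ v → h v ≡ f v ∨ g v) → anyV h ≡ anyV f ∨ anyV g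
anyV-∨ {zero}            _  = refl
anyV-∨ {suc n} {f} {g} {h} h≡f∨g = begin
  anyV h                                        ≡⟨ anyV-suc n h ⟩
  h zero ∨ anyV (h ∘ suc)                       ≡⟨ cong₂ _∨_ (h≡f∨g zero) (anyV-∨ (h≡f∨g ∘ suc)) ⟩
  (f zero ∨ g zero) ∨ (anyV (f ∘ suc) ∨ anyV (g ∘ suc)) ≡⟨ interchange (f zero) (g zero) _ _ ⟩
  (f zero ∨ anyV (f ∘ suc)) ∨ (g zero ∨ anyV (g ∘ suc)) ≡⟨ cong₂ _∨_ (anyV-suc n f) (anyV-suc n g) ⟨
  anyV f ∨ anyV g                               ∎
  where
  open ≡.≡-Reasoning
  open CommSemigroupProperties (CommutativeMonoid.commutativeSemigroup ∨-commutativeMonoid)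
    using (interchange)

disjointFrom-∪ : ∀ {n} (J A B : VSet n) →
  disjointFrom J (λ v → A v ∨ B v) ≡ disjointFrom J A ∧ disjointFrom J B
disjointFrom-∪ J A B = ≡.trans
  (cong not (anyV-∨ {f = λ v → J v ∧ A v} {g = λ v → J v ∧ B v} (λ v → ∧-distribˡ-∨ (J v) (A v) (B v))))
  (deMorgan₂ (anyV (λ v → J v ∧ A v)) (anyV (λ v → J v ∧ B v)))

disjointFrom-cons : ∀ {n} b (S : VSet n) (T : VSet (suc n)) →
  disjointFrom (cons b S) T ≡ not (b ∧ T zero) ∧ disjointFrom S (T ∘ suc)
disjointFrom-cons {n} b S T =
  ≡.trans (cong not (anyV-suc n (λ v → cons b S v ∧ T v))) (deMorgan₂ (b ∧ T zero) _)

module _ {n} (G : Graph n) where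

  adj-sym : ∀ {u v} → adj G u v ≡ true → adj G v u ≡ true
  adj-sym {u} {v} uv = ≡.trans (sym G v u) uv

  leaf-neighbour-unique : ∀ {u} → deg G u ≡ 1 → ∀ {v w} → adj G u v ≡ true → adj G u w ≡ true → v ≡ w
  leaf-neighbour-unique {u} = countV≡1⇒unique {f = adj G u}

  meets-closedNbhd-sym : (S J : VSet n) →
    anyV (λ v → S v ∧ closedNbhd G J v) ≡ true → anyV (λ v → J v ∧ closedNbhd G S v) ≡ true
  meets-closedNbhd-sym S J meets with anyV⁻ meets
  ... | v , Sv∧NJv with ∧-true⁻ {S v} Sv∧NJv
  ... | Sv , NJv with ∨-true⁻ {J v} NJv
  ... | inj₁ Jv = anyV⁺ v (∧-true⁺ Jv (∨-trueˡ Sv))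
  ... | inj₂ J→v with anyV⁻ J→v
  ... | u , Ju∧uv with ∧-true⁻ {J u} Ju∧uv
  ... | Ju , uv = anyV⁺ u (∧-true⁺ Ju (∨-trueʳ (anyV⁺ v (∧-true⁺ Sv (adj-sym uv)))))

  disjointFrom-closedNbhd-comm : (S J : VSet n) →
    disjointFrom S (closedNbhd G J) ≡ disjointFrom J (closedNbhd G S)
  disjointFrom-closedNbhd-comm S J =
    cong not (true-ext (meets-closedNbhd-sym S J) (meets-closedNbhd-sym J S))

  closedNbhd-leaf⇒neighbour : ∀ {S u v} → deg G u ≡ 1 → adj G v u ≡ true →
    closedNbhd G S u ≡ true → closedNbhd G S v ≡ true
  closedNbhd-leaf⇒neighbour {S} {u} {v} leaf vu Nu with ∨-true⁻ {S u} Nu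
  ... | inj₁ Su = ∨-trueʳ (anyV⁺ u (∧-true⁺ Su (adj-sym vu)))
  ... | inj₂ S→u with anyV⁻ S→u
  ... | x , Sx∧xu with ∧-true⁻ {S x} Sx∧xu
  ... | Sx , xu with leaf-neighbour-unique leaf (adj-sym xu) (adj-sym vu)
  ... | refl = ∨-trueˡ Sx

  dominatesOutside : VSet n → VSet n → Bool
  dominatesOutside A S = allV (λ v → A v ∨ closedNbhd G S v)

  dominatesOutside⇒isDominating : NoIsolatedEdges G → ∀ {A} → AdjToLeaf G A →
    ∀ {S} → dominatesOutside A S ≡ true → isDominating G S ≡ true
  dominatesOutside⇒isDominating noIsolatedEdge {A} adjToLeaf {S} domOut = allV⁺ dominated
    where
    covered : ∀ v → A v ∨ closedNbhd G S v ≡ true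
    covered = allV⁻ domOut

    dominated : ∀ v → closedNbhd G S v ≡ true
    dominated v with ∨-true⁻ (covered v)
    ... | inj₂ Nv = Nv
    ... | inj₁ Av with adjToLeaf v Av
    ... | u , vu , leafU with ∨-true⁻ (covered u)
    ... | inj₂ Nu = closedNbhd-leaf⇒neighbour leafU vu Nu
    ... | inj₁ Au with adjToLeaf u Au
    ... | w , uw , leafW with leaf-neighbour-unique leafU (adj-sym vu) uw
    ... | refl = ⊥-elim (noIsolatedEdge v u vu (leafW , leafU))

  dominatesOutside≡isDominating : NoIsolatedEdges G → ∀ {A} → AdjToLeaf G A →
    ∀ S → dominatesOutside A S ≡ isDominating G S
  dominatesOutside≡isDominating noIsolatedEdge {A} adjToLeaf S = true-ext
    (dominatesOutside⇒isDominating noIsolatedEdge adjToLeaf)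
    (λ dom → allV⁺ (λ v → ∨-trueʳ {A v} (allV⁻ dom v)))

module _ {c ℓ : Level} (R : CommutativeRing c ℓ) where
  open CommutativeRing R
    hiding (zero) renaming (refl to ≈-refl; sym to ≈-sym; trans to ≈-trans)
  open RingDefs R
  open SetoidReasoning setoid
  open CommSemigroupProperties +-commutativeSemigroup using (interchange)
  open GroupProperties +-group using (//-rightDividesˡ)
  open RingProperties ring using (-1*x≈-x)

  module _ {X : Set} where
    sumL-cong : (xs : List X) {f g : X → Carrier} → (∀ x → f x ≈ g x) → sumL xs f ≈ sumL xs g
    sumL-cong []       _   = ≈-refl
    sumL-cong (x ∷ xs) f≈g = +-cong (f≈g x) (sumL-cong xs f≈g)

    sumL-++ : (xs ys : List X) (f : X → Carrier) → sumL (xs ++ ys) f ≈ sumL xs f + sumL ys f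
    sumL-++ []       ys f = ≈-sym (+-identityˡ _)
    sumL-++ (x ∷ xs) ys f = ≈-trans (+-congˡ (sumL-++ xs ys f)) (≈-sym (+-assoc _ _ _))

    sumL-zero : (xs : List X) → sumL xs (λ _ → 0#) ≈ 0#
    sumL-zero []       = ≈-refl
    sumL-zero (x ∷ xs) = ≈-trans (+-congˡ (sumL-zero xs)) (+-identityʳ 0#)

    sumL-+ : (xs : List X) (f g : X → Carrier) → sumL xs (λ x → f x + g x) ≈ sumL xs f + sumL xs g
    sumL-+ []       f g = ≈-sym (+-identityˡ 0#)
    sumL-+ (x ∷ xs) f g = ≈-trans (+-congˡ (sumL-+ xs f g)) (interchange _ _ _ _)

    sumL-distribˡ : (xs : List X) (k : Carrier) (f : X → Carrier) →
      k * sumL xs f ≈ sumL xs (λ x → k * f x)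
    sumL-distribˡ []       k f = zeroʳ k
    sumL-distribˡ (x ∷ xs) k f = ≈-trans (distribˡ k _ _) (+-congˡ (sumL-distribˡ xs k f))

    sumL-distribʳ : (xs : List X) (k : Carrier) (f : X → Carrier) →
      sumL xs f * k ≈ sumL xs (λ x → f x * k)
    sumL-distribʳ []       k f = zeroˡ k
    sumL-distribʳ (x ∷ xs) k f = ≈-trans (distribʳ k _ _) (+-congˡ (sumL-distribʳ xs k f))

  sumL-comm : ∀ {X Y : Set} (xs : List X) (ys : List Y) (g : X → Y → Carrier) →
    sumL xs (λ x → sumL ys (g x)) ≈ sumL ys (λ y → sumL xs (λ x → g x y))
  sumL-comm []       ys g = ≈-sym (sumL-zero ys)
  sumL-comm (x ∷ xs) ys g = ≈-trans (+-congˡ (sumL-comm xs ys g)) (≈-sym (sumL-+ ys _ _))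

  sumL-allSubsets-suc : ∀ n (f : VSet (suc n) → Carrier) →
    sumL (allSubsets (suc n)) f ≈ sumL (allSubsets n) (f ∘ cons false) + sumL (allSubsets n) (f ∘ cons true)
  sumL-allSubsets-suc n f = ≈-trans (sumL-++ (map (cons false) subsets) (map (cons true) subsets) f)
    (+-cong (reflexive (foldr-map _ (cons false) 0# subsets)) (reflexive (foldr-map _ (cons true) 0# subsets)))
    where subsets = allSubsets n

  guard-cong : ∀ b {x y} → x ≈ y → (if b then x else 0#) ≈ (if b then y else 0#)
  guard-cong true  x≈y = x≈y
  guard-cong false _   = ≈-refl

  guard-*ˡ : ∀ b k x → (if b then k * x else 0#) ≈ k * (if b then x else 0#)
  guard-*ˡ true  k x = ≈-refl
  guard-*ˡ false k x = ≈-sym (zeroʳ k)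

  guard-*ʳ : ∀ b k x → (if b then x * k else 0#) ≈ (if b then x else 0#) * k
  guard-*ʳ true  k x = ≈-refl
  guard-*ʳ false k x = ≈-sym (zeroˡ k)

  guard-1#-* : ∀ b x → (if b then 1# else 0#) * x ≈ (if b then x else 0#)
  guard-1#-* true  x = *-identityˡ x
  guard-1#-* false x = zeroˡ x

  guard-sumL : ∀ {X : Set} b (xs : List X) (f : X → Carrier) →
    (if b then sumL xs f else 0#) ≈ sumL xs (λ x → if b then f x else 0#)
  guard-sumL true  xs f = ≈-refl
  guard-sumL false xs f = ≈-sym (sumL-zero xs)

  guard-∧ : ∀ a b k x → (if a then k * (if b then x else 0#) else 0#) ≈ (if a ∧ b then k * x else 0#)
  guard-∧ true  b k x = ≈-sym (guard-*ˡ b k x)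
  guard-∧ false b k x = ≈-refl

  prodV-suc : ∀ n (f : Fin (suc n) → Carrier) → prodV f ≡ f zero * prodV (f ∘ suc)
  prodV-suc n f = foldr-allFin-suc n (λ i acc → f i * acc) 1#

  operatingSetProb : ∀ {n} → (Fin n → Carrier) → VSet n → Carrier
  operatingSetProb p S = prodV (λ v → if S v then p v else qOf p v)

  prodV-qOf≈Σ-disjointFrom : ∀ n (p : Fin n → Carrier) (T : VSet n) →
    prodV (λ v → if T v then qOf p v else 1#)
      ≈ sumL (allSubsets n) (λ S → if disjointFrom S T then operatingSetProb p S else 0#)
  prodV-qOf≈Σ-disjointFrom zero    p T = ≈-sym (+-identityʳ 1#)
  prodV-qOf≈Σ-disjointFrom (suc n) p T = begin
    prodV (λ v → if T v then qOf p v else 1#)          ≡⟨ prodV-suc n _ ⟩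
    (if T zero then q₀ else 1#) * Π′                    ≈⟨ *-congˡ (prodV-qOf≈Σ-disjointFrom n p′ T′) ⟩
    (if T zero then q₀ else 1#) * X                     ≈⟨ *-congʳ (q₀-or-1# (T zero)) ⟩
    (q₀ + (if T zero then 0# else p₀)) * X              ≈⟨ distribʳ X _ _ ⟩
    q₀ * X + (if T zero then 0# else p₀) * X            ≈⟨ +-cong (sumL-distribˡ Ss q₀ f′) (sumL-distribˡ Ss _ f′) ⟩
    sumL Ss (λ S → q₀ * f′ S) + sumL Ss (λ S → (if T zero then 0# else p₀) * f′ S)
      ≈⟨ +-cong (sumL-cong Ss absent) (sumL-cong Ss present) ⟨
    sumL Ss (f ∘ cons false) + sumL Ss (f ∘ cons true)  ≈⟨ sumL-allSubsets-suc n f ⟨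
    sumL (allSubsets (suc n)) f                         ∎
    where
    Ss = allSubsets n
    p₀ = p zero
    q₀ = qOf p zero
    p′ = p ∘ suc
    T′ = T ∘ suc
    Π′ = prodV (λ v → if T′ v then qOf p′ v else 1#)
    f : VSet (suc n) → Carrier
    f S = if disjointFrom S T then operatingSetProb p S else 0#
    f′ : VSet n → Carrier
    f′ S = if disjointFrom S T′ then operatingSetProb p′ S else 0#
    X = sumL Ss f′

    q₀-or-1# : ∀ t → (if t then q₀ else 1#) ≈ q₀ + (if t then 0# else p₀)
    q₀-or-1# true  = ≈-sym (+-identityʳ q₀)
    q₀-or-1# false = ≈-sym (//-rightDividesˡ p₀ 1#)

    f-cons : ∀ b S → f (cons b S) ≡
      (if not (b ∧ T zero) ∧ disjointFrom S T′ then (if b then p₀ else q₀) * operatingSetProb p′ S else 0#)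
    f-cons b S = cong₂ (λ d x → if d then x else 0#) (disjointFrom-cons b S T) (prodV-suc n _)

    absent : ∀ S → f (cons false S) ≈ q₀ * f′ S
    absent S = ≈-trans (reflexive (f-cons false S)) (guard-*ˡ (disjointFrom S T′) q₀ _)

    present : ∀ S → f (cons true S) ≈ (if T zero then 0# else p₀) * f′ S
    present S = ≈-trans (reflexive (f-cons true S)) (present-cases (T zero))
      where
      present-cases : ∀ t → (if not t ∧ disjointFrom S T′ then p₀ * operatingSetProb p′ S else 0#)
                         ≈ (if t then 0# else p₀) * f′ S
      present-cases true  = ≈-sym (zeroˡ (f′ S))
      present-cases false = guard-*ˡ (disjointFrom S T′) p₀ _

  card-cons : ∀ {n} b (S : VSet n) → card (cons b S) ≡ (if b then suc (card S) else card S)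
  card-cons {n} b S = countV-suc n (cons b S)

  Σ-disjointFrom-negOnePow≈allV : ∀ n (C : VSet n) →
    sumL (allSubsets n) (λ J → if disjointFrom J C then negOnePow (card J) else 0#)
      ≈ (if allV C then 1# else 0#)
  Σ-disjointFrom-negOnePow≈allV zero    C = +-identityʳ 1#
  Σ-disjointFrom-negOnePow≈allV (suc n) C = begin
    sumL (allSubsets (suc n)) f                              ≈⟨ sumL-allSubsets-suc n f ⟩
    sumL Ss (f ∘ cons false) + sumL Ss (f ∘ cons true)       ≈⟨ +-cong (sumL-cong Ss (reflexive ∘ f-cons false))
                                                                        (sumL-cong Ss (reflexive ∘ f-cons true)) ⟩
    Y + sumL Ss (λ J → if not (C zero) ∧ disjointFrom J C′ then - 1# * negOnePow (card J) else 0#)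
                                                             ≈⟨ combine (C zero) ⟩
    (if C zero ∧ allV C′ then 1# else 0#)                    ≡⟨ cong (λ b → if b then 1# else 0#) (allV-suc n C) ⟨
    (if allV C then 1# else 0#)                              ∎
    where
    Ss = allSubsets n
    C′ = C ∘ suc
    f : VSet (suc n) → Carrier
    f J = if disjointFrom J C then negOnePow (card J) else 0#
    f′ : VSet n → Carrier
    f′ J = if disjointFrom J C′ then negOnePow (card J) else 0#
    Y = sumL Ss f′

    f-cons : ∀ b J → f (cons b J) ≡
      (if not (b ∧ C zero) ∧ disjointFrom J C′ then negOnePow (if b then suc (card J) else card J) else 0#)
    f-cons b J = cong₂ (λ d k → if d then negOnePow k else 0#) (disjointFrom-cons b J C) (card-cons b J)

    combine : ∀ t → Y + sumL Ss (λ J → if not t ∧ disjointFrom J C′ then - 1# * negOnePow (card J) else 0#)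
                      ≈ (if t ∧ allV C′ then 1# else 0#)
    combine true = begin
      Y + sumL Ss (λ _ → 0#)     ≈⟨ +-congˡ (sumL-zero Ss) ⟩
      Y + 0#                     ≈⟨ +-identityʳ Y ⟩
      Y                          ≈⟨ Σ-disjointFrom-negOnePow≈allV n C′ ⟩
      (if allV C′ then 1# else 0#) ∎
    combine false = begin
      Y + sumL Ss (λ J → if disjointFrom J C′ then - 1# * negOnePow (card J) else 0#)
        ≈⟨ +-congˡ (sumL-cong Ss (λ J → guard-*ˡ (disjointFrom J C′) (- 1#) _)) ⟩
      Y + sumL Ss (λ J → - 1# * f′ J)  ≈⟨ +-congˡ (sumL-distribˡ Ss (- 1#) f′) ⟨
      Y + - 1# * Y                     ≈⟨ +-congˡ (-1*x≈-x Y) ⟩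
      Y + - Y                          ≈⟨ -‿inverseʳ Y ⟩
      0#                               ∎

  rhs≈Σ-dominatesOutside : ∀ {n} (G : Graph n) (A : VSet n) (p : Fin n → Carrier) →
    rhs G A p ≈ sumL (allSubsets n) (λ S → if dominatesOutside G A S then operatingSetProb p S else 0#)
  rhs≈Σ-dominatesOutside {n} G A p = begin
    rhs G A p                                        ≈⟨ sumL-cong Ss expand ⟩
    sumL Ss (λ J → sumL Ss (λ S → term J S))         ≈⟨ sumL-comm Ss Ss term ⟩
    sumL Ss (λ S → sumL Ss (λ J → term J S))         ≈⟨ sumL-cong Ss collect ⟩
    sumL Ss (λ S → if dominatesOutside G A S then operatingSetProb p S else 0#) ∎
    where
    Ss = allSubsets n
    sign : VSet n → Carrier
    sign J = negOnePow (card J)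
    A∪N[_] : VSet n → VSet n
    A∪N[ S ] v = A v ∨ closedNbhd G S v
    term : VSet n → VSet n → Carrier
    term J S = if disjointFrom J A∪N[ S ] then sign J * operatingSetProb p S else 0#

    disjointFrom-A∪N : ∀ J S →
      disjointFrom J A ∧ disjointFrom S (closedNbhd G J) ≡ disjointFrom J A∪N[ S ]
    disjointFrom-A∪N J S = ≡.trans (cong (disjointFrom J A ∧_) (disjointFrom-closedNbhd-comm G S J))
                                   (≡.sym (disjointFrom-∪ J A (closedNbhd G S)))

    expand : ∀ J →
      (if disjointFrom J A then sign J * prodV (λ v → if closedNbhd G J v then qOf p v else 1#) else 0#)
        ≈ sumL Ss (term J)
    expand J = begin
      (if dJ then sign J * prodV (λ v → if closedNbhd G J v then qOf p v else 1#) else 0#)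
        ≈⟨ guard-cong dJ (*-congˡ (prodV-qOf≈Σ-disjointFrom n p (closedNbhd G J))) ⟩
      (if dJ then sign J * sumL Ss g else 0#)       ≈⟨ guard-cong dJ (sumL-distribˡ Ss (sign J) g) ⟩
      (if dJ then sumL Ss (λ S → sign J * g S) else 0#) ≈⟨ guard-sumL dJ Ss _ ⟩
      sumL Ss (λ S → if dJ then sign J * g S else 0#)
        ≈⟨ sumL-cong Ss (λ S → guard-∧ dJ (disjointFrom S (closedNbhd G J)) (sign J) _) ⟩
      sumL Ss (λ S → if dJ ∧ disjointFrom S (closedNbhd G J) then sign J * operatingSetProb p S else 0#)
        ≈⟨ sumL-cong Ss (λ S → reflexive (cong (λ d → if d then sign J * operatingSetProb p S else 0#)
                                         (disjointFrom-A∪N J S))) ⟩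
      sumL Ss (term J) ∎
      where
      dJ = disjointFrom J A
      g : VSet n → Carrier
      g S = if disjointFrom S (closedNbhd G J) then operatingSetProb p S else 0#

    collect : ∀ S → sumL Ss (λ J → term J S) ≈ (if dominatesOutside G A S then operatingSetProb p S else 0#)
    collect S = begin
      sumL Ss (λ J → term J S)
        ≈⟨ sumL-cong Ss (λ J → guard-*ʳ (disjointFrom J A∪N[ S ]) w (sign J)) ⟩
      sumL Ss (λ J → (if disjointFrom J A∪N[ S ] then sign J else 0#) * w) ≈⟨ sumL-distribʳ Ss w _ ⟨
      sumL Ss (λ J → if disjointFrom J A∪N[ S ] then sign J else 0#) * w
        ≈⟨ *-congʳ (Σ-disjointFrom-negOnePow≈allV n A∪N[ S ]) ⟩
      (if dominatesOutside G A S then 1# else 0#) * w                  ≈⟨ guard-1#-* (dominatesOutside G A S) w ⟩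
      (if dominatesOutside G A S then w else 0#) ∎
      where w = operatingSetProb p S

corollary3 : {c ℓ : Level} (R : CommutativeRing c ℓ) → let open CommutativeRing R in
    (n : ℕ) (G : Graph n) → NoIsolatedVertices G → NoIsolatedEdges G →
    (A : VSet n) → AdjToLeaf G A →
    (p : Fin n → Carrier) →
    RingDefs.DRel R G p ≈ RingDefs.rhs R G A p
corollary3 R n G _ noIsolatedEdge A adjToLeaf p = ≈-sym (begin
  rhs G A p
    ≈⟨ rhs≈Σ-dominatesOutside R G A p ⟩
  sumL (allSubsets n) (λ S → if dominatesOutside G A S then operatingSetProb R p S else 0#)
    ≈⟨ sumL-cong R (allSubsets n) (λ S → CommutativeRing.reflexive R (cong (λ d → if d then operatingSetProb R p S else 0#)
                                          (dominatesOutside≡isDominating G noIsolatedEdge adjToLeaf S))) ⟩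
  DRel G p ∎)
  where
  open CommutativeRing R using (0#) renaming (sym to ≈-sym)
  open RingDefs R
  open SetoidReasoning (CommutativeRing.setoid R)
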